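{- Let $l\ge3$, $d\ge1$, let $Y\subseteq V$ be an open set and let $\sim$ be an equivalence relation on $Y$. (i) If $L\subseteq Y$, then there is $f\in W(l,d)$ with $Ker(f)=\sim$ if and only if the restriction of $\sim$ to $L$ is either the identity relation or the universal relation on $L$. (ii) If $L\not\subseteq Y$, then there is $f\in W(l,d)$ with $Ker(f)=\sim$ if and only if the restriction of $\sim$ to $L\cap Y$ is the universal relation on $L\cap Y$. (iii) For every $f\in W(l,d)$ there is an idempotent $e\in W(l,d)$ with $Ker(f)=Ker(e)$.
   Context: For $l\ge3$, $d\ge1$, let $V=\{1,\dots,l+d\}$, $L=\{1,\dots,l\}$, $D=\{l+1,\dots,l+d\}$, and let $M(l,d)$ be the pairwise balanced design on $V$ whose blocks are $L$ together with all $\{i,j\}$ with $l+1\le j\le l+d$, $1\le i<j$. A subsystem is a set $F\subseteq V$ such that for all distinct $x,y\in F$ the unique block containing $x,y$ lies in $F$; a set is open if its complement is a subsystem. For a partial function $f$, $f^{ -w}(B)=f^{ -1}(B)\cup(V\setminus Dom(f))$; $W(l,d)$ is the monoid (under composition) of all partial functions $f:V\to V$ such that $f^{ -w}(F)$ is a subsystem for every subsystem $F$. $Ker(f)$ is the equivalence relation on $Dom(f)$ with $x\sim y$ iff $f(x)=f(y)$ (so $Ker(f)=\sim$ entails $Dom(f)=Y$). The restriction of $\sim$ to $Z\subseteq Y$ is $\sim\cap(Z\times Z)$. -}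

module Defs where

open import Data.Nat using (ℕ; _+_; _<_; _≤_)
open import Data.Fin using (Fin; toℕ)
open import Data.Fin.Subset using (Subset; _∈_; _⊆_; _∪_; ⁅_⁆)
open import Data.Bool using (Bool; true; false)
open import Data.Maybe using (Maybe; just; nothing; maybe; _>>=_)
open import Data.Vec using (tabulate; lookup)
open import Data.Product using (_×_; ∃)
open import Data.Sum using (_⊎_)
open import Relation.Binary.PropositionalEquality using (_≡_; _≢_)
open import Relation.Nullary using (¬_)

-- Points of V = {1,…,l+d} are represented 0-based by Fin (l + d):
-- the point i+1 of the paper is the element i with toℕ i = i.
-- Thus L = {x | toℕ x < l} and D = {x | l ≤ toℕ x}.

Pt : ℕ → ℕ → Set
Pt l d = Fin (l + d)

Lset : (l d : ℕ) → Subset (l + d)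
Lset l d = tabulate (λ x → isL x)
  where
  isL : Fin (l + d) → Bool
  isL x with Data.Nat._<?_ (toℕ x) l
  ... | Relation.Nullary.yes _ = true
  ... | Relation.Nullary.no _ = false

IsBlock : (l d : ℕ) → Subset (l + d) → Set
IsBlock l d B =
  (B ≡ Lset l d)
  ⊎ ∃ λ (i : Fin (l + d)) → ∃ λ (j : Fin (l + d)) →
      (l ≤ toℕ j) × (toℕ i < toℕ j) × (B ≡ ⁅ i ⁆ ∪ ⁅ j ⁆)

Subsystem : (l d : ℕ) → Subset (l + d) → Set
Subsystem l d F =
  ∀ (B : Subset (l + d)) → IsBlock l d B →
  ∀ (x y : Fin (l + d)) → x ≢ y → x ∈ B → y ∈ B → x ∈ F → y ∈ F → B ⊆ F

Open : (l d : ℕ) → Subset (l + d) → Set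
Open l d Y = Subsystem l d (Data.Fin.Subset.∁ Y)

PFun : ℕ → Set
PFun n = Fin n → Maybe (Fin n)

-- f^{-w}(B) = f^{-1}(B) ∪ (V ∖ Dom f)
preimW : {n : ℕ} → PFun n → Subset n → Subset n
preimW f B = tabulate (λ x → maybe (lookup B) true (f x))

InW : (l d : ℕ) → PFun (l + d) → Set
InW l d f = ∀ (F : Subset (l + d)) → Subsystem l d F → Subsystem l d (preimW f F)

_∘ₚ_ : {n : ℕ} → PFun n → PFun n → PFun n
(g ∘ₚ f) x = f x >>= g

Idempotent : {n : ℕ} → PFun n → Set
Idempotent e = ∀ x → (e ∘ₚ e) x ≡ e x

Ker : {n : ℕ} → PFun n → Fin n → Fin n → Set
Ker f x y = ∃ λ a → (f x ≡ just a) × (f y ≡ just a)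

BRel : ℕ → Set
BRel n = Fin n → Fin n → Bool

IsEquivOn : {n : ℕ} → Subset n → BRel n → Set
IsEquivOn Y R =
  (∀ x y → R x y ≡ true → (x ∈ Y) × (y ∈ Y))
  × (∀ x → x ∈ Y → R x x ≡ true)
  × (∀ x y → R x y ≡ true → R y x ≡ true)
  × (∀ x y z → R x y ≡ true → R y z ≡ true → R x z ≡ true)

-- Ker(f) = R as sets of pairs (hence Dom f = Y)
KerIs : {n : ℕ} → PFun n → BRel n → Set
KerIs f R = ∀ x y → (R x y ≡ true → Ker f x y) × (Ker f x y → R x y ≡ true)

SameKer : {n : ℕ} → PFun n → PFun n → Set
SameKer f g = ∀ x y → (Ker f x y → Ker g x y) × (Ker g x y → Ker f x y)

Restr : {n : ℕ} → BRel n → Subset n → Fin n → Fin n → Set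
Restr R Z x y = (x ∈ Z) × (y ∈ Z) × (R x y ≡ true)

RestrIsIdentity : {n : ℕ} → BRel n → Subset n → Set
RestrIsIdentity R Z =
  ∀ x y → (Restr R Z x y → (x ∈ Z) × (x ≡ y)) × ((x ∈ Z) × (x ≡ y) → Restr R Z x y)

RestrIsUniversal : {n : ℕ} → BRel n → Subset n → Set
RestrIsUniversal R Z =
  ∀ x y → (Restr R Z x y → (x ∈ Z) × (y ∈ Z)) × ((x ∈ Z) × (y ∈ Z) → Restr R Z x y)

ExistsWKer : (l d : ℕ) → BRel (l + d) → Set
ExistsWKer l d R = ∃ λ (f : PFun (l + d)) → InW l d f × KerIs f R

module Submission where

-- The only block of M(l,d) with more than two points is L, so a set P is a
-- subsystem iff it is "L-closed": two distinct points of L in P force L ⊆ P.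
-- Applied to the weak preimages of the subsystems ∅ and {p} this yields the
-- two facts about a map f ∈ W(l,d) that drive the argument:
--   * Dom f is open;
--   * if two distinct points of L lie in f^{-w}{p}, then f sends every point
--     of L ∩ Dom f to p ("collapse").
-- From collapse, the kernel R of f (an equivalence on Y = Dom f) is
-- "admissible": either L ⊆ Y and R is the identity on L, or R is universal
-- on L ∩ Y.  Conversely, for any equivalence R on an open Y the map sending
-- x to the least element R-related to it is an idempotent with kernel R, and
-- it lies in W(l,d) whenever R is admissible.  Parts (i) and (ii) of the
-- theorem unfold "admissible" in the two cases L ⊆ Y and L ⊈ Y; part (iii)
-- applies the same two facts to Y = Dom f and R = Ker f.

open import Defs
open import Data.Nat as ℕ using (ℕ; _+_; _≤_; _<_; z≤n; s≤s)
open import Data.Nat.Properties using (≤-<-trans; ≤-trans; n≤1+n; m≤m+n)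
open import Data.Fin using (Fin; zero; suc; toℕ; fromℕ<; _≟_)
open import Data.Fin.Properties using (toℕ-fromℕ<; ¬∀⟶∃¬)
open import Data.Fin.Subset using (Subset; _∈_; _∉_; _⊆_; _∩_; ∁; ⁅_⁆; _∪_; ⊥)
open import Data.Fin.Subset.Properties
  using (_∈?_; _⊆?_; x∈p∩q⁺; x∈p∩q⁻; p∩q⊆p; x∈p∪q⁻; x∈⁅x⁆; x∈⁅y⁆⇒x≡y; x∈∁p⇒x∉p; x∉p⇒x∈∁p; ∉⊥)
open import Data.Vec using (tabulate; lookup)
open import Data.Vec.Properties using ([]=⇒lookup; lookup⇒[]=; lookup∘tabulate)
open import Data.Bool using (Bool; true; false)
open import Data.Maybe using (Maybe; just; nothing; is-just)
import Data.Maybe as Maybe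
open import Data.Maybe.Properties using (just-injective)
open import Data.Product using (_×_; ∃; _,_; proj₁; proj₂)
open import Data.Sum using (_⊎_; inj₁; inj₂)
open import Data.Empty using (⊥-elim)
open import Relation.Nullary using (¬_; yes; no; does)
open import Relation.Nullary.Decidable using (_→-dec_)
open import Relation.Binary.PropositionalEquality using (_≡_; _≢_; refl; sym; trans; cong; subst)

private
  variable
    n : ℕ

first : (Fin n → Bool) → Maybe (Fin n)
first {ℕ.zero} p = nothing
first {ℕ.suc n} p with p zero
... | true = just zero
... | false = Maybe.map suc (first (λ k → p (suc k)))

first-sound : (p : Fin n → Bool) {m : Fin n} → first p ≡ just m → p m ≡ true
first-sound {ℕ.suc n} p e with p zero in p0
first-sound {ℕ.suc n} p refl | true = p0
... | false with first (λ k → p (suc k)) in rest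
first-sound {ℕ.suc n} p refl | false | just m = first-sound (λ k → p (suc k)) rest

first-least : (p : Fin n → Bool) {m : Fin n} (k : Fin n) → first p ≡ just m → p k ≡ true → toℕ m ≤ toℕ k
first-least {ℕ.suc n} p k e pk with p zero in p0
first-least {ℕ.suc n} p k refl pk | true = z≤n
... | false with first (λ k → p (suc k)) in rest
first-least {ℕ.suc n} p zero refl pk | false | just m with trans (sym p0) pk
... | ()
first-least {ℕ.suc n} p (suc k) refl pk | false | just m = s≤s (first-least (λ k → p (suc k)) k rest pk)

first-complete : (p : Fin n → Bool) (k : Fin n) → p k ≡ true → ∃ λ m → first p ≡ just m
first-complete {ℕ.suc n} p k pk with p zero in p0
... | true = zero , refl
... | false with first (λ k → p (suc k)) in rest
... | just m = suc m , refl
first-complete {ℕ.suc n} p zero pk | false | nothing with trans (sym p0) pk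
... | ()
first-complete {ℕ.suc n} p (suc k) pk | false | nothing with first-complete (λ k → p (suc k)) k pk
... | m , found with trans (sym rest) found
... | ()

first-none : (p : Fin n → Bool) → (∀ k → p k ≡ false) → first p ≡ nothing
first-none p never with first p in eq
... | nothing = refl
... | just m with trans (sym (never m)) (first-sound p eq)
... | ()

first-cong : (p q : Fin n → Bool) → (∀ k → p k ≡ q k) → first p ≡ first q
first-cong {ℕ.zero} p q same = refl
first-cong {ℕ.suc n} p q same with p zero | q zero | same zero
... | true | true | _ = refl
... | false | false | _ rewrite first-cong (λ k → p (suc k)) (λ k → q (suc k)) (λ k → same (suc k)) = refl

bool-ext : {a b : Bool} → (a ≡ true → b ≡ true) → (b ≡ true → a ≡ true) → a ≡ b
bool-ext {true} {true} _ _ = refl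
bool-ext {true} {false} a⇒b _ = sym (a⇒b refl)
bool-ext {false} {true} _ b⇒a = b⇒a refl
bool-ext {false} {false} _ _ = refl

∈-tabulate⁺ : (χ : Fin n → Bool) {x : Fin n} → χ x ≡ true → x ∈ tabulate χ
∈-tabulate⁺ χ {x} χx = lookup⇒[]= x (tabulate χ) (trans (lookup∘tabulate χ x) χx)

∈-tabulate⁻ : (χ : Fin n → Bool) {x : Fin n} → x ∈ tabulate χ → χ x ≡ true
∈-tabulate⁻ χ {x} x∈ = trans (sym (lookup∘tabulate χ x)) ([]=⇒lookup x∈)

⊈-witness : (P Q : Subset n) → ¬ (P ⊆ Q) → ∃ λ c → c ∈ P × c ∉ Q
⊈-witness {n} P Q P⊈Q with ¬∀⟶∃¬ n (λ x → x ∈ P → x ∈ Q) (λ x → (x ∈? P) →-dec (x ∈? Q)) (λ h → P⊈Q (h _))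
... | c , ¬c∈P⇒c∈Q with c ∈? P
...   | yes c∈P = c , c∈P , (λ c∈Q → ¬c∈P⇒c∈Q (λ _ → c∈Q))
...   | no c∉P = ⊥-elim (¬c∈P⇒c∈Q (λ c∈P → ⊥-elim (c∉P c∈P)))

data WPre (f : PFun n) (F : Subset n) (x : Fin n) : Set where
  undefined : f x ≡ nothing → WPre f F x
  maps-into : {m : Fin n} → f x ≡ just m → m ∈ F → WPre f F x

preimW⁺ : (f : PFun n) (F : Subset n) {x : Fin n} → WPre f F x → x ∈ preimW f F
preimW⁺ f F (undefined fx) = ∈-tabulate⁺ _ (cong (Maybe.maybe (lookup F) true) fx)
preimW⁺ f F (maps-into fx m∈F) = ∈-tabulate⁺ _ (trans (cong (Maybe.maybe (lookup F) true) fx) ([]=⇒lookup m∈F))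

preimW⁻ : (f : PFun n) (F : Subset n) {x : Fin n} → x ∈ preimW f F → WPre f F x
preimW⁻ f F {x} x∈ = classify (f x) refl (∈-tabulate⁻ _ x∈)
  where
  classify : ∀ r → f x ≡ r → Maybe.maybe (lookup F) true r ≡ true → WPre f F x
  classify nothing fx _ = undefined fx
  classify (just m) fx Fm = maps-into fx (lookup⇒[]= m F Fm)

preimW-fibre : (f : PFun n) (F : Subset n) {x z : Fin n} → f z ≡ f x → x ∈ preimW f F → z ∈ preimW f F
preimW-fibre f F fz≡fx x∈ with preimW⁻ f F x∈
... | undefined fx = preimW⁺ f F (undefined (trans fz≡fx fx))
... | maps-into fx m∈F = preimW⁺ f F (maps-into (trans fz≡fx fx) m∈F)

module KernelOn {Y : Subset n} {R : BRel n} (eqv : IsEquivOn Y R) {f : PFun n} (ker : KerIs f R) where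

  defined-on : {x : Fin n} → x ∈ Y → ∃ λ a → f x ≡ just a
  defined-on {x} x∈Y with proj₁ (ker x x) (proj₁ (proj₂ eqv) x x∈Y)
  ... | a , fx , _ = a , fx

  undefined-off : {x : Fin n} → x ∉ Y → f x ≡ nothing
  undefined-off {x} x∉Y with f x in fx
  ... | nothing = refl
  ... | just a = ⊥-elim (x∉Y (proj₁ (proj₁ eqv x x (proj₂ (ker x x) (a , fx , fx)))))

same-kernel : {R : BRel n} {f g : PFun n} → KerIs f R → KerIs g R → SameKer f g
same-kernel kerf kerg x y = (λ k → proj₁ (kerg x y) (proj₂ (kerf x y) k)) , (λ k → proj₁ (kerf x y) (proj₂ (kerg x y) k))

domain : PFun n → Subset n
domain f = tabulate (λ x → is-just (f x))

domain⁺ : (f : PFun n) {x : Fin n} {a : Fin n} → f x ≡ just a → x ∈ domain f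
domain⁺ f fx = ∈-tabulate⁺ _ (cong is-just fx)

domain⁻ : (f : PFun n) {x : Fin n} → x ∈ domain f → ∃ λ a → f x ≡ just a
domain⁻ f {x} x∈ = defined (f x) refl (∈-tabulate⁻ _ x∈)
  where
  defined : ∀ r → f x ≡ r → is-just r ≡ true → ∃ λ a → f x ≡ just a
  defined (just a) fx _ = a , fx

∁domain⁺ : (f : PFun n) {x : Fin n} → f x ≡ nothing → x ∈ ∁ (domain f)
∁domain⁺ f {x} fx = x∉p⇒x∈∁p (λ x∈ → undefined≢just (domain⁻ f x∈))
  where
  undefined≢just : ¬ (∃ λ a → f x ≡ just a)
  undefined≢just (a , fx′) with trans (sym fx) fx′
  ... | ()

∁domain⁻ : (f : PFun n) {x : Fin n} → x ∈ ∁ (domain f) → f x ≡ nothing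
∁domain⁻ f {x} x∈ with f x in fx
... | nothing = refl
... | just a = ⊥-elim (x∈∁p⇒x∉p x∈ (domain⁺ f fx))

kernelRel : PFun n → BRel n
kernelRel f x y with f x | f y
... | just a | just b = does (a ≟ b)
... | _ | _ = false

kernelRel-is-kernel : (f : PFun n) → KerIs f (kernelRel f)
kernelRel-is-kernel f x y = to , from
  where
  to : kernelRel f x y ≡ true → Ker f x y
  to h with f x | f y
  to h | just a | just b with a ≟ b
  to h | just a | just b | yes refl = a , refl , refl
  from : Ker f x y → kernelRel f x y ≡ true
  from (a , fx , fy) rewrite fx | fy with a ≟ a
  ... | yes _ = refl
  ... | no a≢a = ⊥-elim (a≢a refl)

kernelRel-equiv : (f : PFun n) → IsEquivOn (domain f) (kernelRel f)
kernelRel-equiv f = in-domain , reflexive , symmetric , transitive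
  where
  K : KerIs f (kernelRel f)
  K = kernelRel-is-kernel f
  in-domain : ∀ x y → kernelRel f x y ≡ true → (x ∈ domain f) × (y ∈ domain f)
  in-domain x y r with proj₁ (K x y) r
  ... | a , fx , fy = domain⁺ f fx , domain⁺ f fy
  reflexive : ∀ x → x ∈ domain f → kernelRel f x x ≡ true
  reflexive x x∈ with domain⁻ f x∈
  ... | a , fx = proj₂ (K x x) (a , fx , fx)
  symmetric : ∀ x y → kernelRel f x y ≡ true → kernelRel f y x ≡ true
  symmetric x y r with proj₁ (K x y) r
  ... | a , fx , fy = proj₂ (K y x) (a , fy , fx)
  transitive : ∀ x y z → kernelRel f x y ≡ true → kernelRel f y z ≡ true → kernelRel f x z ≡ true
  transitive x y z r s with proj₁ (K x y) r | proj₁ (K y z) s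
  ... | a , fx , fy | b , fy' , fz with just-injective (trans (sym fy) fy')
  ... | refl = proj₂ (K x z) (a , fx , fz)

module LeastRepresentative {Y : Subset n} {R : BRel n} (eqv : IsEquivOn Y R) where

  R-support : ∀ x y → R x y ≡ true → (x ∈ Y) × (y ∈ Y)
  R-support = proj₁ eqv

  R-refl : ∀ x → x ∈ Y → R x x ≡ true
  R-refl = proj₁ (proj₂ eqv)

  R-sym : ∀ x y → R x y ≡ true → R y x ≡ true
  R-sym = proj₁ (proj₂ (proj₂ eqv))

  R-trans : ∀ x y z → R x y ≡ true → R y z ≡ true → R x z ≡ true
  R-trans = proj₂ (proj₂ (proj₂ eqv))

  rep : PFun n
  rep x = first (R x)

  rep-defined : {x : Fin n} → x ∈ Y → ∃ λ m → rep x ≡ just m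
  rep-defined {x} x∈Y = first-complete (R x) x (R-refl x x∈Y)

  rep-undefined : {x : Fin n} → x ∉ Y → rep x ≡ nothing
  rep-undefined {x} x∉Y = first-none (R x) (λ k → unrelated k (R x k) refl)
    where
    unrelated : ∀ k b → R x k ≡ b → b ≡ false
    unrelated k true r = ⊥-elim (x∉Y (proj₁ (R-support x k r)))
    unrelated k false _ = refl

  rep-related : {x m : Fin n} → rep x ≡ just m → R x m ≡ true
  rep-related {x} = first-sound (R x)

  rep-least : {x m : Fin n} → rep x ≡ just m → x ∈ Y → toℕ m ≤ toℕ x
  rep-least {x} repx x∈Y = first-least (R x) x repx (R-refl x x∈Y)

  -- Related points have related-sets with the same truth table.
  rep-cong : {x y : Fin n} → R x y ≡ true → rep x ≡ rep y
  rep-cong {x} {y} r = first-cong (R x) (R y) (λ k → bool-ext (R-trans y x k (R-sym x y r)) (R-trans x y k r))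

  rep-kernel : KerIs rep R
  rep-kernel x y = to , from
    where
    to : R x y ≡ true → Ker rep x y
    to r with rep-defined (proj₁ (R-support x y r))
    ... | m , repx = m , repx , trans (sym (rep-cong r)) repx
    from : Ker rep x y → R x y ≡ true
    from (a , repx , repy) = R-trans x a y (rep-related repx) (R-sym y a (rep-related repy))

  rep-idempotent : Idempotent rep
  rep-idempotent x with rep x in repx
  ... | nothing = refl
  ... | just m = trans (rep-cong (R-sym x m (rep-related repx))) repx

IdentityOn : Subset n → BRel n → Set
IdentityOn Z R = ∀ x y → x ∈ Z → y ∈ Z → R x y ≡ true → x ≡ y

UniversalOn : Subset n → BRel n → Set
UniversalOn Z R = ∀ x y → x ∈ Z → y ∈ Z → R x y ≡ true

UniversalOn-⊆ : {Z Z′ : Subset n} {R : BRel n} → Z′ ⊆ Z → UniversalOn Z R → UniversalOn Z′ R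
UniversalOn-⊆ Z′⊆Z univ x y x∈ y∈ = univ x y (Z′⊆Z x∈) (Z′⊆Z y∈)

restrIdentity⁻ : {Z : Subset n} {R : BRel n} → RestrIsIdentity R Z → IdentityOn Z R
restrIdentity⁻ ident x y x∈ y∈ r = proj₂ (proj₁ (ident x y) (x∈ , y∈ , r))

restrIdentity⁺ : {Z : Subset n} {R : BRel n} → (∀ x → x ∈ Z → R x x ≡ true) → IdentityOn Z R → RestrIsIdentity R Z
restrIdentity⁺ refl-on ident x y = (λ { (x∈ , y∈ , r) → x∈ , ident x y x∈ y∈ r }) , λ { (x∈ , refl) → x∈ , x∈ , refl-on x x∈ }

restrUniversal⁻ : {Z : Subset n} {R : BRel n} → RestrIsUniversal R Z → UniversalOn Z R
restrUniversal⁻ univ x y x∈ y∈ = proj₂ (proj₂ (proj₂ (univ x y) (x∈ , y∈)))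

restrUniversal⁺ : {Z : Subset n} {R : BRel n} → UniversalOn Z R → RestrIsUniversal R Z
restrUniversal⁺ univ x y = (λ { (x∈ , y∈ , _) → x∈ , y∈ }) , λ { (x∈ , y∈) → x∈ , y∈ , univ x y x∈ y∈ }

module Design (l d : ℕ) where

  V : Set
  V = Fin (l + d)

  L : Subset (l + d)
  L = Lset l d

  ∈L⇒< : {x : V} → x ∈ L → toℕ x < l
  ∈L⇒< {x} x∈L with toℕ x ℕ.<? l | ∈-tabulate⁻ _ x∈L
  ... | yes x<l | _ = x<l

  <⇒∈L : {x : V} → toℕ x < l → x ∈ L
  <⇒∈L {x} x<l = lookup⇒[]= x L (true-below-l (lookup L x) refl)
    where
    true-below-l : ∀ b → lookup L x ≡ b → b ≡ true
    true-below-l true _ = refl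
    true-below-l false Lx with trans (sym (lookup∘tabulate _ x)) Lx
    ... | isLx with toℕ x ℕ.<? l
    true-below-l false Lx | () | yes _
    ... | no x≮l = ⊥-elim (x≮l x<l)

  two-points-of-L : 2 ≤ l → ∃ λ (p₀ : V) → ∃ λ (p₁ : V) → p₀ ∈ L × p₁ ∈ L × p₀ ≢ p₁
  two-points-of-L 2≤l = p₀ , p₁ , p₀∈L , p₁∈L , p₀≢p₁
    where
    2≤l+d : 2 ≤ l + d
    2≤l+d = ≤-trans 2≤l (m≤m+n l d)
    p₀ p₁ : V
    p₀ = fromℕ< (≤-trans (s≤s z≤n) 2≤l+d)
    p₁ = fromℕ< 2≤l+d
    p₀∈L : p₀ ∈ L
    p₀∈L = <⇒∈L (subst (_< l) (sym (toℕ-fromℕ< _)) (≤-trans (s≤s z≤n) 2≤l))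
    p₁∈L : p₁ ∈ L
    p₁∈L = <⇒∈L (subst (_< l) (sym (toℕ-fromℕ< _)) 2≤l)
    p₀≢p₁ : p₀ ≢ p₁
    p₀≢p₁ eq with trans (sym (toℕ-fromℕ< _)) (trans (cong toℕ eq) (toℕ-fromℕ< _))
    ... | ()

  LClosed : Subset (l + d) → Set
  LClosed P = ∀ x y → x ≢ y → x ∈ L → y ∈ L → x ∈ P → y ∈ P → L ⊆ P

  pair-spanned : {i j x y z : V} → x ≢ y →
    x ∈ ⁅ i ⁆ ∪ ⁅ j ⁆ → y ∈ ⁅ i ⁆ ∪ ⁅ j ⁆ → z ∈ ⁅ i ⁆ ∪ ⁅ j ⁆ → z ≡ x ⊎ z ≡ y
  pair-spanned {i} {j} x≢y x∈ y∈ z∈ with member x∈ | member y∈ | member z∈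
    where
    member : {w : V} → w ∈ ⁅ i ⁆ ∪ ⁅ j ⁆ → w ≡ i ⊎ w ≡ j
    member {w} w∈ with x∈p∪q⁻ ⁅ i ⁆ ⁅ j ⁆ w∈
    ... | inj₁ w∈i = inj₁ (x∈⁅y⁆⇒x≡y i w∈i)
    ... | inj₂ w∈j = inj₂ (x∈⁅y⁆⇒x≡y j w∈j)
  ... | inj₁ refl | _ | inj₁ refl = inj₁ refl
  ... | inj₂ refl | _ | inj₂ refl = inj₁ refl
  ... | inj₁ refl | inj₁ refl | _ = ⊥-elim (x≢y refl)
  ... | inj₂ refl | inj₂ refl | _ = ⊥-elim (x≢y refl)
  ... | inj₁ refl | inj₂ refl | inj₂ refl = inj₂ refl
  ... | inj₂ refl | inj₁ refl | inj₁ refl = inj₂ refl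

  LClosed⇒Subsystem : (P : Subset (l + d)) → LClosed P → Subsystem l d P
  LClosed⇒Subsystem P closed B (inj₁ refl) x y x≢y x∈B y∈B x∈P y∈P = closed x y x≢y x∈B y∈B x∈P y∈P
  LClosed⇒Subsystem P closed B (inj₂ (i , j , _ , _ , refl)) x y x≢y x∈B y∈B x∈P y∈P z∈B
    with pair-spanned x≢y x∈B y∈B z∈B
  ... | inj₁ refl = x∈P
  ... | inj₂ refl = y∈P

  Subsystem⇒LClosed : (P : Subset (l + d)) → Subsystem l d P → LClosed P
  Subsystem⇒LClosed P sub = sub L (inj₁ refl)

  ∅-subsystem : Subsystem l d ⊥
  ∅-subsystem = LClosed⇒Subsystem ⊥ (λ _ _ _ _ _ x∈⊥ _ → ⊥-elim (∉⊥ x∈⊥))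

  singleton-subsystem : (p : V) → Subsystem l d ⁅ p ⁆
  singleton-subsystem p = LClosed⇒Subsystem ⁅ p ⁆ λ x y x≢y _ _ x∈ y∈ →
    ⊥-elim (x≢y (trans (x∈⁅y⁆⇒x≡y p x∈) (sym (x∈⁅y⁆⇒x≡y p y∈))))

  -- The domain of a weak morphism is open: its complement is f^{-w}(∅).
  domain-open : {f : PFun (l + d)} → InW l d f → Open l d (domain f)
  domain-open {f} W = LClosed⇒Subsystem (∁ (domain f)) closed
    where
    ∅-closed : LClosed (preimW f ⊥)
    ∅-closed = Subsystem⇒LClosed _ (W ⊥ ∅-subsystem)
    to-preim : {x : V} → x ∈ ∁ (domain f) → x ∈ preimW f ⊥
    to-preim x∈ = preimW⁺ f ⊥ (undefined (∁domain⁻ f x∈))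
    from-preim : {x : V} → x ∈ preimW f ⊥ → x ∈ ∁ (domain f)
    from-preim x∈ with preimW⁻ f ⊥ x∈
    ... | undefined fx = ∁domain⁺ f fx
    ... | maps-into _ m∈⊥ = ⊥-elim (∉⊥ m∈⊥)
    closed : LClosed (∁ (domain f))
    closed x y x≢y x∈L y∈L x∈ y∈ z∈L = from-preim (∅-closed x y x≢y x∈L y∈L (to-preim x∈) (to-preim y∈) z∈L)

  Admissible : Subset (l + d) → BRel (l + d) → Set
  Admissible Y R = (L ⊆ Y × IdentityOn L R) ⊎ UniversalOn (L ∩ Y) R

  module Necessary {Y : Subset (l + d)} {R : BRel (l + d)} (eqv : IsEquivOn Y R)
                   {f : PFun (l + d)} (W : InW l d f) (ker : KerIs f R) where
    open KernelOn eqv ker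
    open LeastRepresentative eqv using (R-sym; R-trans)

    -- If a ∈ L ∩ Y and a second point b of L is undefined or R-related to a,
    -- then f collapses L ∩ Y onto the class of a, since f^{-w}{f a} is L-closed.
    collapse : {a b : V} → a ∈ L → a ∈ Y → b ∈ L → a ≢ b → f b ≡ nothing ⊎ R a b ≡ true →
               ∀ z → z ∈ L → z ∈ Y → R a z ≡ true
    collapse {a} {b} a∈L a∈Y b∈L a≢b b-in-fibre z z∈L z∈Y
      with defined-on a∈Y
    ... | p , fa with preimW⁻ f ⁅ p ⁆ (fibre-closed a b a≢b a∈L b∈L a∈fibre (b∈fibre b-in-fibre) z∈L)
      where
      fibre-closed : LClosed (preimW f ⁅ p ⁆)
      fibre-closed = Subsystem⇒LClosed _ (W ⁅ p ⁆ (singleton-subsystem p))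
      a∈fibre : a ∈ preimW f ⁅ p ⁆
      a∈fibre = preimW⁺ f ⁅ p ⁆ (maps-into fa (x∈⁅x⁆ p))
      b∈fibre : f b ≡ nothing ⊎ R a b ≡ true → b ∈ preimW f ⁅ p ⁆
      b∈fibre (inj₁ fb) = preimW⁺ f ⁅ p ⁆ (undefined fb)
      b∈fibre (inj₂ r) with proj₁ (ker a b) r
      ... | q , fa′ , fb = preimW⁺ f ⁅ p ⁆ (maps-into (trans fb (trans (sym fa′) fa)) (x∈⁅x⁆ p))
    ...   | maps-into fz m∈ rewrite x∈⁅y⁆⇒x≡y p m∈ = proj₂ (ker a z) (p , fa , fz)
    ...   | undefined fz with defined-on z∈Y
    ...     | _ , fz′ with trans (sym fz) fz′
    ...       | ()

    -- Case L ⊆ Y: R is universal on L if two fixed points of L are related,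
    -- and otherwise it is the identity on L.
    admissible-inside : (p₀ p₁ : V) → p₀ ∈ L → p₁ ∈ L → p₀ ≢ p₁ → L ⊆ Y → Admissible Y R
    admissible-inside p₀ p₁ p₀∈L p₁∈L p₀≢p₁ L⊆Y with R p₀ p₁ in r
    ... | true = inj₂ universal
      where
      universal : UniversalOn (L ∩ Y) R
      universal x y x∈ y∈ = R-trans x p₀ y (R-sym p₀ x (via-p₀ x x∈)) (via-p₀ y y∈)
        where
        via-p₀ : ∀ z → z ∈ L ∩ Y → R p₀ z ≡ true
        via-p₀ z z∈ = collapse p₀∈L (L⊆Y p₀∈L) p₁∈L p₀≢p₁ (inj₂ r) z (proj₁ (x∈p∩q⁻ L Y z∈)) (proj₂ (x∈p∩q⁻ L Y z∈))
    ... | false = inj₁ (L⊆Y , identity)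
      where
      identity : IdentityOn L R
      identity x y x∈L y∈L rxy with x ≟ y
      ... | yes x≡y = x≡y
      ... | no x≢y with R-trans p₀ x p₁ (R-sym x p₀ (via-x p₀∈L)) (via-x p₁∈L)
        where
        via-x : {z : V} → z ∈ L → R x z ≡ true
        via-x z∈L = collapse x∈L (L⊆Y x∈L) y∈L x≢y (inj₂ rxy) _ z∈L (L⊆Y z∈L)
      ... | r′ with trans (sym r) r′
      ...   | ()

    -- Case c ∈ L ∖ Y: the undefined point c collapses L ∩ Y to one class.
    admissible-outside : {c : V} → c ∈ L → c ∉ Y → Admissible Y R
    admissible-outside c∈L c∉Y = inj₂ universal
      where
      universal : UniversalOn (L ∩ Y) R
      universal x y x∈ y∈ =
        collapse x∈L x∈Y c∈L (λ { refl → c∉Y x∈Y }) (inj₁ (undefined-off c∉Y)) y (proj₁ (x∈p∩q⁻ L Y y∈)) (proj₂ (x∈p∩q⁻ L Y y∈))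
        where
        x∈L : x ∈ L
        x∈L = proj₁ (x∈p∩q⁻ L Y x∈)
        x∈Y : x ∈ Y
        x∈Y = proj₂ (x∈p∩q⁻ L Y x∈)

    admissible : 2 ≤ l → Admissible Y R
    admissible 2≤l with L ⊆? Y
    ... | yes L⊆Y = let (p₀ , p₁ , p₀∈L , p₁∈L , p₀≢p₁) = two-points-of-L 2≤l in admissible-inside p₀ p₁ p₀∈L p₁∈L p₀≢p₁ L⊆Y
    ... | no L⊈Y = let (c , c∈L , c∉Y) = ⊈-witness L Y L⊈Y in admissible-outside c∈L c∉Y

  module Sufficient {Y : Subset (l + d)} {R : BRel (l + d)} (eqv : IsEquivOn Y R) where
    open LeastRepresentative eqv

    -- If R is the identity on L ⊆ Y, the least representative fixes L,
    -- because a representative of x ∈ L has smaller index and so lies in L.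
    rep-fixes-L : L ⊆ Y → IdentityOn L R → {x : V} → x ∈ L → rep x ≡ just x
    rep-fixes-L L⊆Y ident {x} x∈L with rep-defined (L⊆Y x∈L)
    ... | m , repx = subst (λ q → rep x ≡ just q) m≡x repx
      where
      m∈L : m ∈ L
      m∈L = <⇒∈L (≤-<-trans (rep-least repx (L⊆Y x∈L)) (∈L⇒< x∈L))
      m≡x : m ≡ x
      m≡x = ident m x m∈L x∈L (R-sym x m (rep-related repx))

    -- Then rep⁻ʷ(F) meets L in F ∩ L, so it inherits L-closedness from F.
    rep-in-W-identity : L ⊆ Y → IdentityOn L R → InW l d rep
    rep-in-W-identity L⊆Y ident F F-sub = LClosed⇒Subsystem (preimW rep F) closed
      where
      fixes : {x : V} → x ∈ L → rep x ≡ just x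
      fixes = rep-fixes-L L⊆Y ident
      in-F : {x : V} → x ∈ L → x ∈ preimW rep F → x ∈ F
      in-F x∈L x∈ with preimW⁻ rep F x∈
      ... | maps-into repx m∈F rewrite just-injective (trans (sym (fixes x∈L)) repx) = m∈F
      ... | undefined repx with trans (sym repx) (fixes x∈L)
      ...   | ()
      closed : LClosed (preimW rep F)
      closed x y x≢y x∈L y∈L x∈ y∈ z∈L =
        preimW⁺ rep F (maps-into (fixes z∈L) (Subsystem⇒LClosed F F-sub x y x≢y x∈L y∈L (in-F x∈L x∈) (in-F y∈L y∈) z∈L))

    -- If R is universal on L ∩ Y and Y is open, a point z of L ∩ Y has the
    -- same image as any point of L ∩ Y, and two distinct points of L cannot
    -- both lie outside Y unless z does too.
    rep-in-W-universal : Open l d Y → UniversalOn (L ∩ Y) R → InW l d rep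
    rep-in-W-universal Y-open univ F F-sub = LClosed⇒Subsystem (preimW rep F) closed
      where
      outside-closed : LClosed (∁ Y)
      outside-closed = Subsystem⇒LClosed (∁ Y) Y-open
      same-image : {x z : V} → z ∈ L → z ∈ Y → x ∈ L → x ∈ Y → x ∈ preimW rep F → z ∈ preimW rep F
      same-image z∈L z∈Y x∈L x∈Y = preimW-fibre rep F (rep-cong (univ _ _ (x∈p∩q⁺ (z∈L , z∈Y)) (x∈p∩q⁺ (x∈L , x∈Y))))
      closed : LClosed (preimW rep F)
      closed x y x≢y x∈L y∈L x∈ y∈ {z} z∈L with z ∈? Y | x ∈? Y | y ∈? Y
      ... | no z∉Y | _ | _ = preimW⁺ rep F (undefined (rep-undefined z∉Y))
      ... | yes z∈Y | yes x∈Y | _ = same-image z∈L z∈Y x∈L x∈Y x∈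
      ... | yes z∈Y | no _ | yes y∈Y = same-image z∈L z∈Y y∈L y∈Y y∈
      ... | yes z∈Y | no x∉Y | no y∉Y =
        ⊥-elim (x∈∁p⇒x∉p (outside-closed x y x≢y x∈L y∈L (x∉p⇒x∈∁p x∉Y) (x∉p⇒x∈∁p y∉Y) z∈L) z∈Y)

    rep-in-W : Open l d Y → Admissible Y R → InW l d rep
    rep-in-W _ (inj₁ (L⊆Y , ident)) = rep-in-W-identity L⊆Y ident
    rep-in-W Y-open (inj₂ univ) = rep-in-W-universal Y-open univ

  kernel-criterion : 2 ≤ l → {Y : Subset (l + d)} {R : BRel (l + d)} → Open l d Y → IsEquivOn Y R →
    (ExistsWKer l d R → Admissible Y R) × (Admissible Y R → ExistsWKer l d R)
  kernel-criterion 2≤l Y-open eqv =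
    (λ { (f , W , ker) → Necessary.admissible eqv W ker 2≤l }) ,
    (λ adm → rep , Sufficient.rep-in-W eqv Y-open adm , rep-kernel)
    where open LeastRepresentative eqv using (rep; rep-kernel)

  part-i : 2 ≤ l → {Y : Subset (l + d)} {R : BRel (l + d)} → Open l d Y → IsEquivOn Y R → L ⊆ Y →
    (ExistsWKer l d R → RestrIsIdentity R L ⊎ RestrIsUniversal R L)
    × (RestrIsIdentity R L ⊎ RestrIsUniversal R L → ExistsWKer l d R)
  part-i 2≤l {Y} {R} Y-open eqv L⊆Y =
    (λ ex → restrict (proj₁ criterion ex)) , (λ restr → proj₂ criterion (admit restr))
    where
    open LeastRepresentative eqv using (R-refl)
    criterion : (ExistsWKer l d R → Admissible Y R) × (Admissible Y R → ExistsWKer l d R)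
    criterion = kernel-criterion 2≤l Y-open eqv
    L⊆L∩Y : L ⊆ L ∩ Y
    L⊆L∩Y x∈L = x∈p∩q⁺ (x∈L , L⊆Y x∈L)
    restrict : Admissible Y R → RestrIsIdentity R L ⊎ RestrIsUniversal R L
    restrict (inj₁ (_ , ident)) = inj₁ (restrIdentity⁺ (λ x x∈L → R-refl x (L⊆Y x∈L)) ident)
    restrict (inj₂ univ) = inj₂ (restrUniversal⁺ (UniversalOn-⊆ L⊆L∩Y univ))
    admit : RestrIsIdentity R L ⊎ RestrIsUniversal R L → Admissible Y R
    admit (inj₁ ident) = inj₁ (L⊆Y , restrIdentity⁻ ident)
    admit (inj₂ univ) = inj₂ (UniversalOn-⊆ (p∩q⊆p L Y) (restrUniversal⁻ univ))

  part-ii : 2 ≤ l → {Y : Subset (l + d)} {R : BRel (l + d)} → Open l d Y → IsEquivOn Y R → ¬ (L ⊆ Y) →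
    (ExistsWKer l d R → RestrIsUniversal R (L ∩ Y)) × (RestrIsUniversal R (L ∩ Y) → ExistsWKer l d R)
  part-ii 2≤l {Y} {R} Y-open eqv L⊈Y =
    (λ ex → restrict (proj₁ criterion ex)) , (λ univ → proj₂ criterion (inj₂ (restrUniversal⁻ univ)))
    where
    criterion : (ExistsWKer l d R → Admissible Y R) × (Admissible Y R → ExistsWKer l d R)
    criterion = kernel-criterion 2≤l Y-open eqv
    restrict : Admissible Y R → RestrIsUniversal R (L ∩ Y)
    restrict (inj₁ (L⊆Y , _)) = ⊥-elim (L⊈Y L⊆Y)
    restrict (inj₂ univ) = restrUniversal⁺ univ

  -- Part (iii): Ker f is an admissible equivalence on the open set Dom f, so
  -- its least-representative map is an idempotent of W(l,d) with the same kernel.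
  part-iii : 2 ≤ l → (f : PFun (l + d)) → InW l d f →
    ∃ λ (e : PFun (l + d)) → InW l d e × Idempotent e × SameKer f e
  part-iii 2≤l f W =
    rep , Sufficient.rep-in-W eqv (domain-open W) (Necessary.admissible eqv W ker 2≤l) , rep-idempotent ,
    same-kernel ker rep-kernel
    where
    eqv : IsEquivOn (domain f) (kernelRel f)
    eqv = kernelRel-equiv f
    ker : KerIs f (kernelRel f)
    ker = kernelRel-is-kernel f
    open LeastRepresentative eqv using (rep; rep-kernel; rep-idempotent)

-- Lemma 9.4.
lemma9p4 : (l d : ℕ) → 3 ≤ l → 1 ≤ d →
    ((Y : Subset (l + d)) → (R : BRel (l + d)) → Open l d Y → IsEquivOn Y R →
      (Lset l d ⊆ Y →
        (ExistsWKer l d R → RestrIsIdentity R (Lset l d) ⊎ RestrIsUniversal R (Lset l d))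
        × (RestrIsIdentity R (Lset l d) ⊎ RestrIsUniversal R (Lset l d) → ExistsWKer l d R))
      × (¬ (Lset l d ⊆ Y) →
        (ExistsWKer l d R → RestrIsUniversal R (Lset l d ∩ Y))
        × (RestrIsUniversal R (Lset l d ∩ Y) → ExistsWKer l d R)))
    × ((f : PFun (l + d)) → InW l d f →
        ∃ λ (e : PFun (l + d)) → InW l d e × Idempotent e × SameKer f e)
lemma9p4 l d 3≤l _ =
  (λ Y R Y-open eqv → part-i 2≤l Y-open eqv , part-ii 2≤l Y-open eqv) , part-iii 2≤l
  where
  open Design l d
  2≤l : 2 ≤ l
  2≤l = ≤-trans (n≤1+n 2) 3≤l
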